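{- Let $G$ be a finite simple graph with rational weights $w:E(G)\to[0,\infty)\cap\mathbb{Q}$ and thresholds $\tau:V(G)\to[0,\infty)$, and let $\ell$ be the least common multiple of the denominators (in lowest terms) of the weights. Let $H=H(G,w)$ be the simple graph obtained from $G$ by: for each edge $e=uv$, deleting $e$ if $\ell w(e)=0$; keeping $e$ if $\ell w(e)=1$; and if $k=\ell w(e)\ge2$, keeping $uv$ and adding $k-1$ new ("middle") vertices each adjacent exactly to $u$ and $v$. Define $\tau'$ on $V(H)$ by $\tau'(x)=1$ for every middle vertex $x$ and $\tau'(u)=\ell\tau(u)$ for $u\in V(G)$. Then $dyn(G,w,\tau)=dyn_{\tau'}(H)$.
   Context: Activation process in $(G,w,\tau)$: start with initially active set $D_0=D$; a vertex $u\notin D_i$ becomes active at phase $i+1$ iff $\sum w(uv)\ge\tau(u)$, the sum over edges $uv$ with $v\in D_i$; active vertices remain active. $D$ is a dynamic monopoly if eventually all vertices are active; $dyn(G,w,\tau)$ is the minimum size of a dynamic monopoly. For an unweighted graph $H$ with thresholds $\tau'$ the same process is used with all edge weights $1$ (a vertex becomes active once at least $\tau'(u)$ of its neighbors are active), and $dyn_{\tau'}(H)$ is the minimum size of a $\tau'$-dynamic monopoly.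
   Formalization: The thresholds τ take values in the nonnegative rationals instead of $[0,\infty)$. -}

module Defs where

open import Data.Bool using (Bool; true; false; _∧_; _∨_; if_then_else_)
open import Data.Nat as ℕ using (ℕ; zero; suc; _∸_; _≤_; _<ᵇ_; _≡ᵇ_)
open import Data.Nat.DivMod using (_/_)
open import Data.Nat.LCM using (lcm)
open import Data.Integer as ℤ using (+_; ∣_∣)
open import Data.Rational as ℚ using (ℚ; 0ℚ; 1ℚ; ↥_; ↧ₙ_; _≤ᵇ_)
open import Data.Fin using (Fin; toℕ)
open import Data.List using (List; []; _∷_; map; filterᵇ; foldr; length; allFin; concatMap; cartesianProduct; _++_)
open import Data.Product using (Σ; _×_; _,_; ∃; proj₁; proj₂)
open import Data.Sum using (_⊎_; inj₁; inj₂)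
open import Relation.Binary.PropositionalEquality using (_≡_)
open import Function using (_∘_)

-- Generic finite graphs: a vertex type with a complete, duplicate-free
-- enumeration of its vertices, and a Boolean adjacency relation.

record FinGraph : Set₁ where
  field
    V     : Set
    verts : List V
    adj   : V → V → Bool

sumℚ : List ℚ → ℚ
sumℚ = foldr ℚ._+_ 0ℚ

ℕ→ℚ : ℕ → ℚ
ℕ→ℚ n = (+ n) ℚ./ 1

module Process (G : FinGraph) (w : FinGraph.V G → FinGraph.V G → ℚ)
               (τ : FinGraph.V G → ℚ) where
  open FinGraph G

  VSet : Set
  VSet = V → Bool

  received : VSet → V → ℚ
  received D u = sumℚ (map (w u) (filterᵇ (λ v → adj u v ∧ D v) verts))

  step : VSet → VSet
  step D u = D u ∨ (τ u ≤ᵇ received D u)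

  phase : ℕ → VSet → VSet
  phase zero    D = D
  phase (suc i) D = step (phase i D)

  IsDynMonopoly : VSet → Set
  IsDynMonopoly D = ∃ λ i → ∀ v → phase i D v ≡ true

  size : VSet → ℕ
  size D = length (filterᵇ D verts)

  DynIs : ℕ → Set
  DynIs k = (∃ λ D → IsDynMonopoly D × size D ≡ k)
          × (∀ D → IsDynMonopoly D → k ≤ size D)

DynW : (G : FinGraph) → (FinGraph.V G → FinGraph.V G → ℚ)
     → (FinGraph.V G → ℚ) → ℕ → Set
DynW G w τ = Process.DynIs G w τ

DynU : (H : FinGraph) → (FinGraph.V H → ℚ) → ℕ → Set
DynU H τ' = Process.DynIs H (λ _ _ → 1ℚ) τ'

module Construction (n : ℕ) (adj : Fin n → Fin n → Bool) (w : Fin n → Fin n → ℚ) where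

  G : FinGraph
  G = record { V = Fin n ; verts = allFin n ; adj = adj }

  pairs : List (Fin n × Fin n)
  pairs = cartesianProduct (allFin n) (allFin n)

  edgePairs : List (Fin n × Fin n)
  edgePairs = filterᵇ (λ p → adj (proj₁ p) (proj₂ p)) pairs

  ℓ : ℕ
  ℓ = foldr lcm 1 (map (λ p → ↧ₙ (w (proj₁ p) (proj₂ p))) edgePairs)

  -- k(u,v) = ℓ · w(uv) as a natural number (the denominator divides ℓ)
  kk : Fin n → Fin n → ℕ
  kk u v = ∣ ↥ (w u v) ∣ ℕ.* (ℓ / ↧ₙ (w u v))

  -- number of middle vertices attached to the pair (u,v): for every edge
  -- uv (counted once, with u < v) there are k(u,v) - 1 middle vertices
  mids : Fin n × Fin n → ℕ
  mids (u , v) = if (toℕ u <ᵇ toℕ v) ∧ adj u v then kk u v ∸ 1 else 0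

  Mid : Set
  Mid = Σ (Fin n × Fin n) (λ p → Fin (mids p))

  midList : List Mid
  midList = concatMap (λ p → map (p ,_) (allFin (mids p))) pairs

  VH : Set
  VH = Fin n ⊎ Mid

  eqF : Fin n → Fin n → Bool
  eqF a b = toℕ a ≡ᵇ toℕ b

  adjH : VH → VH → Bool
  adjH (inj₁ u) (inj₁ v) = adj u v ∧ (1 ℕ.≤ᵇ kk u v)   -- delete e iff ℓw(e)=0
  adjH (inj₁ u) (inj₂ ((a , b) , _)) = eqF u a ∨ eqF u b
  adjH (inj₂ ((a , b) , _)) (inj₁ u) = eqF u a ∨ eqF u b
  adjH (inj₂ _) (inj₂ _) = false

  H : FinGraph
  H = record { V = VH ; verts = map inj₁ (allFin n) ++ map inj₂ midList ; adj = adjH }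

  τ' : (Fin n → ℚ) → VH → ℚ
  τ' τ (inj₁ u) = ℕ→ℚ ℓ ℚ.* τ u
  τ' τ (inj₂ _) = 1ℚ

module Submission where

-- Multiplying all weights and thresholds of G by ℓ changes no threshold comparison and makes every
-- edge weight an integer k = ℓ·w(uv).  In H this weight is carried by a gadget of k unit-weight
-- neighbours of u: the edge uv itself (present iff k ≥ 1) and the k − 1 middle vertices of uv, each of
-- threshold 1 and hence active one phase after one of its ends.  So a dynamic monopoly of G is one of H,
-- every phase of G being simulated by two phases of H (middle vertices first).  Conversely, moving each
-- middle vertex of a monopoly of H to an end of its edge gives a monopoly of G that is no larger: along
-- the phases, an active middle vertex of H has an active end in G, and an original vertex inactive in G
-- receives in H at most ℓ times its input in G, because the gadget of an inactive neighbour is inactive.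

open import Algebra.Properties.CommutativeSemigroup using (interchange)
open import Data.Bool using (Bool; true; false; _∧_; _∨_; if_then_else_)
open import Data.Bool.Properties using (T-≡; ¬-not; ∧-identityʳ; ∧-zeroʳ; ∧-conicalˡ; ∨-zeroʳ)
open import Data.Fin as Fin using (Fin; toℕ)
open import Data.Fin.Properties using (toℕ-injective)
open import Data.Integer as ℤ using (∣_∣)
import Data.Integer.Properties as ℤ
open import Data.List using (List; []; _∷_; map; filterᵇ; foldr; length; allFin; concatMap; cartesianProduct; _++_)
open import Data.List.Membership.Propositional using (_∈_)
open import Data.List.Membership.Propositional.Properties using (∈-allFin; ∈-map⁺; ∈-filter⁺; ∈-cartesianProduct⁺)
open import Data.List.Properties using (map-++; map-cong; map-∘; map-tabulate; length-tabulate)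
open import Data.List.Relation.Unary.Any using (here; there)
open import Data.Nat as ℕ using (ℕ; zero; suc; _+_; _*_; _∸_; _≤_; _<_; z≤n; s≤s; _≡ᵇ_; _<ᵇ_; NonZero)
open import Data.Nat.Coprimality as Coprime using ()
open import Data.Nat.Divisibility using (_∣_; divides; ∣-trans)
open import Data.Nat.DivMod using (_/_; m*n/n≡m)
open import Data.Nat.GCD using (gcd)
open import Data.Nat.LCM using (lcm; m∣lcm[m,n]; n∣lcm[m,n]; gcd*lcm)
open import Data.Nat.ListAction using (sum)
open import Data.Nat.ListAction.Properties using (sum-++)
open import Data.Nat.Properties
open import Data.Nat.Tactic.RingSolver using (solve-∀)
open import Data.Product using (∃; _×_; _,_; proj₁; proj₂)
open import Data.Rational as ℚ using (ℚ; mkℚ; 0ℚ; 1ℚ; ↥_; ↧ₙ_)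
import Data.Rational.Properties as ℚ
import Data.Rational.Unnormalised as ℚᵘ
import Data.Rational.Unnormalised.Properties as ℚᵘ
open import Data.Sum as Sum using (_⊎_; inj₁; inj₂)
open import Function using (id; _∘_; case_of_)
open import Function.Bundles using (_⇔_; mk⇔; Equivalence)
open import Relation.Binary.Definitions using (tri<; tri≈; tri>)
open import Relation.Binary.PropositionalEquality
open import Relation.Nullary using (¬_; contradiction)
open import Relation.Nullary.Decidable using (T?)
open import Defs

-- Iverson brackets and sums over lists

⟦_⟧ : Bool → ℕ
⟦ true ⟧  = 1
⟦ false ⟧ = 0

∑ : {A : Set} → List A → (A → ℕ) → ℕ
∑ xs f = sum (map f xs)

infix 5 ∑
syntax ∑ xs (λ x → e) = ∑[ x ∈ xs ] e

module _ {A : Set} where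

  length-filterᵇ : (p : A → Bool) (xs : List A) → length (filterᵇ p xs) ≡ ∑[ x ∈ xs ] ⟦ p x ⟧
  length-filterᵇ p [] = refl
  length-filterᵇ p (x ∷ xs) with p x
  ... | true  = cong suc (length-filterᵇ p xs)
  ... | false = length-filterᵇ p xs

  ∑-++ : (f : A → ℕ) (xs ys : List A) → ∑ (xs ++ ys) f ≡ ∑ xs f + ∑ ys f
  ∑-++ f xs ys = trans (cong sum (map-++ f xs ys)) (sum-++ (map f xs) (map f ys))

  ∑-cong : {f g : A → ℕ} → (∀ x → f x ≡ g x) → (xs : List A) → ∑ xs f ≡ ∑ xs g
  ∑-cong f≗g xs = cong sum (map-cong f≗g xs)

  ∑-mono : {f g : A → ℕ} → (∀ x → f x ≤ g x) → (xs : List A) → ∑ xs f ≤ ∑ xs g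
  ∑-mono f≤g []       = z≤n
  ∑-mono f≤g (x ∷ xs) = +-mono-≤ (f≤g x) (∑-mono f≤g xs)

  ∑-zero : {f : A → ℕ} → (∀ x → f x ≡ 0) → (xs : List A) → ∑ xs f ≡ 0
  ∑-zero f≗0 xs = trans (∑-cong f≗0 xs) (∑-const-0 xs)
    where
    ∑-const-0 : (xs : List A) → ∑[ x ∈ xs ] 0 ≡ 0
    ∑-const-0 []       = refl
    ∑-const-0 (x ∷ xs) = ∑-const-0 xs

  ∑-+ : (f g : A → ℕ) (xs : List A) → ∑[ x ∈ xs ] (f x + g x) ≡ ∑ xs f + ∑ xs g
  ∑-+ f g []       = refl
  ∑-+ f g (x ∷ xs) =
    trans (cong (f x + g x +_) (∑-+ f g xs)) (interchange +-commutativeSemigroup (f x) (g x) (∑ xs f) (∑ xs g))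

  ∑-*ˡ : (k : ℕ) (f : A → ℕ) (xs : List A) → ∑[ x ∈ xs ] k * f x ≡ k * ∑ xs f
  ∑-*ˡ k f []       = sym (*-zeroʳ k)
  ∑-*ˡ k f (x ∷ xs) = trans (cong (k * f x +_) (∑-*ˡ k f xs)) (sym (*-distribˡ-+ k (f x) _))

  ∑-≤-length : {f : A → ℕ} → (∀ x → f x ≤ 1) → (xs : List A) → ∑ xs f ≤ length xs
  ∑-≤-length f≤1 []       = z≤n
  ∑-≤-length f≤1 (x ∷ xs) = +-mono-≤ (f≤1 x) (∑-≤-length f≤1 xs)

  ∑-length : {f : A → ℕ} → (∀ x → f x ≡ 1) → (xs : List A) → ∑ xs f ≡ length xs
  ∑-length f≗1 []       = refl
  ∑-length f≗1 (x ∷ xs) = cong₂ _+_ (f≗1 x) (∑-length f≗1 xs)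

∑-map : {A B : Set} (f : B → ℕ) (g : A → B) (xs : List A) → ∑ (map g xs) f ≡ ∑[ x ∈ xs ] f (g x)
∑-map f g xs = cong sum (sym (map-∘ xs))

module _ {A B : Set} where

  ∑-concatMap : (f : B → ℕ) (h : A → List B) (xs : List A) → ∑ (concatMap h xs) f ≡ ∑[ x ∈ xs ] ∑ (h x) f
  ∑-concatMap f h []       = refl
  ∑-concatMap f h (x ∷ xs) = trans (∑-++ f (h x) (concatMap h xs)) (cong (∑ (h x) f +_) (∑-concatMap f h xs))

  ∑-cartesianProduct : (f : A × B → ℕ) (xs : List A) (ys : List B)
                     → ∑ (cartesianProduct xs ys) f ≡ ∑[ x ∈ xs ] ∑[ y ∈ ys ] f (x , y)
  ∑-cartesianProduct f []       ys = refl
  ∑-cartesianProduct f (x ∷ xs) ys =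
    trans (∑-++ f (map (x ,_) ys) _) (cong₂ _+_ (∑-map f (x ,_) ys) (∑-cartesianProduct f xs ys))

∑-member : {A : Set} (f : A → ℕ) {x : A} {xs : List A} → x ∈ xs → f x ≤ ∑ xs f
∑-member f {xs = y ∷ ys} (here refl) = m≤m+n (f y) (∑ ys f)
∑-member f {xs = y ∷ ys} (there x∈ys) = ≤-trans (∑-member f x∈ys) (m≤n+m (∑ ys f) (f y))

∑-allFin-suc : ∀ {n} (f : Fin (suc n) → ℕ) → ∑ (allFin (suc n)) f ≡ f Fin.zero + (∑[ i ∈ allFin n ] f (Fin.suc i))
∑-allFin-suc f = cong (f Fin.zero +_)
  (trans (cong sum (map-tabulate Fin.suc f)) (sym (cong sum (map-tabulate id (f ∘ Fin.suc)))))

∑-allFin-length : (m : ℕ) {f : Fin m → ℕ} → (∀ j → f j ≡ 1) → ∑ (allFin m) f ≡ m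
∑-allFin-length m f≗1 = trans (∑-length f≗1 (allFin m)) (length-tabulate id)

∑-allFin-≤-length : (m : ℕ) {f : Fin m → ℕ} → (∀ j → f j ≤ 1) → ∑ (allFin m) f ≤ m
∑-allFin-≤-length m {f} f≤1 = subst (∑ (allFin m) f ≤_) (length-tabulate id) (∑-≤-length f≤1 (allFin m))

∑-delta : ∀ {n} (u : Fin n) (g : Fin n → ℕ) → (∑[ v ∈ allFin n ] ⟦ toℕ v ≡ᵇ toℕ u ⟧ * g v) ≡ g u
∑-delta {suc n} Fin.zero g = trans (∑-allFin-suc (λ v → ⟦ toℕ v ≡ᵇ 0 ⟧ * g v))
  (trans (cong₂ _+_ (*-identityˡ (g Fin.zero)) (∑-zero (λ _ → refl) (allFin n))) (+-identityʳ _))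
∑-delta {suc n} (Fin.suc u) g = trans (∑-allFin-suc (λ v → ⟦ toℕ v ≡ᵇ suc (toℕ u) ⟧ * g v)) (∑-delta u (g ∘ Fin.suc))

≡ᵇ-sym : ∀ m n → (m ≡ᵇ n) ≡ (n ≡ᵇ m)
≡ᵇ-sym zero    zero    = refl
≡ᵇ-sym zero    (suc n) = refl
≡ᵇ-sym (suc m) zero    = refl
≡ᵇ-sym (suc m) (suc n) = ≡ᵇ-sym m n

∑-deltaˡ : ∀ {n} (u : Fin n) (g : Fin n → ℕ) → (∑[ v ∈ allFin n ] ⟦ toℕ u ≡ᵇ toℕ v ⟧ * g v) ≡ g u
∑-deltaˡ u g = trans (∑-cong (λ v → cong (λ b → ⟦ b ⟧ * g v) (≡ᵇ-sym (toℕ u) (toℕ v))) (allFin _)) (∑-delta u g)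

⟦⟧≤1 : ∀ x → ⟦ x ⟧ ≤ 1
⟦⟧≤1 true  = ≤-refl
⟦⟧≤1 false = z≤n

⟦∧⟧ : ∀ x y → ⟦ x ∧ y ⟧ ≡ ⟦ x ⟧ * ⟦ y ⟧
⟦∧⟧ true  true  = refl
⟦∧⟧ true  false = refl
⟦∧⟧ false y     = refl

⟦∧⟧≤ˡ : ∀ x y → ⟦ x ∧ y ⟧ ≤ ⟦ x ⟧
⟦∧⟧≤ˡ true  y = ⟦⟧≤1 y
⟦∧⟧≤ˡ false y = z≤n

⟦∨⟧≤ : ∀ x y → ⟦ x ∨ y ⟧ ≤ ⟦ x ⟧ + ⟦ y ⟧
⟦∨⟧≤ true  y = s≤s z≤n
⟦∨⟧≤ false y = ≤-refl

⟦∨⟧-*-split : ∀ x y m → (x ∧ y ≡ true → m ≡ 0) → ⟦ x ∨ y ⟧ * m ≡ ⟦ x ⟧ * m + ⟦ y ⟧ * m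
⟦∨⟧-*-split true  true  m m≡0 rewrite m≡0 refl = refl
⟦∨⟧-*-split true  false m _   = sym (+-identityʳ _)
⟦∨⟧-*-split false y     m _   = refl

⟦1≤ᵇ⟧≤ : ∀ m → ⟦ 1 ℕ.≤ᵇ m ⟧ ≤ m
⟦1≤ᵇ⟧≤ zero    = z≤n
⟦1≤ᵇ⟧≤ (suc m) = s≤s z≤n

⟦1≤ᵇ⟧+∸1 : ∀ m → ⟦ 1 ℕ.≤ᵇ m ⟧ + (m ∸ 1) ≡ m
⟦1≤ᵇ⟧+∸1 zero    = refl
⟦1≤ᵇ⟧+∸1 (suc m) = refl

1≤⟦⟧+⟦⟧⇒true⊎true : ∀ x y → 1 ≤ ⟦ x ⟧ + ⟦ y ⟧ → x ≡ true ⊎ y ≡ true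
1≤⟦⟧+⟦⟧⇒true⊎true true  y     _ = inj₁ refl
1≤⟦⟧+⟦⟧⇒true⊎true false true  _ = inj₂ refl

true⊎true⇒1≤⟦⟧+⟦⟧ : ∀ x y → x ≡ true ⊎ y ≡ true → 1 ≤ ⟦ x ⟧ + ⟦ y ⟧
true⊎true⇒1≤⟦⟧+⟦⟧ x y (inj₁ refl) = s≤s z≤n
true⊎true⇒1≤⟦⟧+⟦⟧ x y (inj₂ refl) = m≤n+m 1 ⟦ x ⟧

<ᵇ-true : ∀ {m n} → m < n → (m <ᵇ n) ≡ true
<ᵇ-true m<n = Equivalence.to T-≡ (<⇒<ᵇ m<n)

<ᵇ-false : ∀ {m n} → ¬ m < n → (m <ᵇ n) ≡ false
<ᵇ-false {m} {n} m≮n = ¬-not λ m<ᵇn → m≮n (<ᵇ⇒< m n (Equivalence.from T-≡ m<ᵇn))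

≡ᵇ-∧-≡ᵇ : ∀ l m n → (l ≡ᵇ m) ∧ (l ≡ᵇ n) ≡ true → m ≡ n
≡ᵇ-∧-≡ᵇ l m n eqs with l ≡ᵇ m in l≡ᵇm
... | true = trans (sym (≡ᵇ⇒≡ l m (Equivalence.from T-≡ l≡ᵇm))) (≡ᵇ⇒≡ l n (Equivalence.from T-≡ eqs))

-- Least common multiples

lcm-nonZero : ∀ m n .{{_ : NonZero m}} .{{_ : NonZero n}} → NonZero (lcm m n)
lcm-nonZero m n = ℕ.≢-nonZero λ lcm≡0 → ℕ.≢-nonZero⁻¹ (m * n) {{m*n≢0 m n}} (begin
  m * n             ≡⟨ gcd*lcm m n ⟨
  gcd m n * lcm m n ≡⟨ cong (gcd m n *_) lcm≡0 ⟩
  gcd m n * 0       ≡⟨ *-zeroʳ (gcd m n) ⟩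
  0                 ∎)
  where open ≡-Reasoning

foldr-lcm-nonZero : {A : Set} (f : A → ℕ) → (∀ x → NonZero (f x)) → (xs : List A) → NonZero (foldr lcm 1 (map f xs))
foldr-lcm-nonZero f f≢0 []       = _
foldr-lcm-nonZero f f≢0 (x ∷ xs) = lcm-nonZero (f x) _ {{f≢0 x}} {{foldr-lcm-nonZero f f≢0 xs}}

∣-foldr-lcm : ∀ {m ms} → m ∈ ms → m ∣ foldr lcm 1 ms
∣-foldr-lcm {ms = m ∷ ms}  (here refl)  = m∣lcm[m,n] m (foldr lcm 1 ms)
∣-foldr-lcm {ms = m′ ∷ ms} (there m∈ms) = ∣-trans (∣-foldr-lcm m∈ms) (n∣lcm[m,n] m′ (foldr lcm 1 ms))

-- Natural numbers as rationals

private
  fromℕ : ℕ → ℚ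
  fromℕ n = mkℚ (ℤ.+ n) 0 (Coprime.sym (Coprime.1-coprimeTo n))

  ℕ→ℚ≡fromℕ : ∀ n → ℕ→ℚ n ≡ fromℕ n
  ℕ→ℚ≡fromℕ n = ℚ.↥p/↧p≡p (fromℕ n)

ℕ→ℚ-+ : ∀ m n → ℕ→ℚ (m + n) ≡ ℕ→ℚ m ℚ.+ ℕ→ℚ n
ℕ→ℚ-+ m n rewrite ℕ→ℚ≡fromℕ m | ℕ→ℚ≡fromℕ n | ℕ→ℚ≡fromℕ (m + n) =
  ℚ.toℚᵘ-injective (ℚᵘ.≃-trans (ℚᵘ.*≡* cross) (ℚᵘ.≃-sym (ℚ.toℚᵘ-homo-+ (fromℕ m) (fromℕ n))))
  where
  cross : ℤ.+ (m + n) ℤ.* ℤ.+ 1 ≡ (ℤ.+ m ℤ.* ℤ.+ 1 ℤ.+ ℤ.+ n ℤ.* ℤ.+ 1) ℤ.* ℤ.+ 1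
  cross = begin
    ℤ.+ (m + n) ℤ.* ℤ.+ 1                             ≡⟨ ℤ.*-identityʳ _ ⟩
    ℤ.+ (m + n)                                       ≡⟨ ℤ.pos-+ m n ⟩
    ℤ.+ m ℤ.+ ℤ.+ n                                   ≡⟨ cong₂ ℤ._+_ (ℤ.*-identityʳ (ℤ.+ m)) (ℤ.*-identityʳ (ℤ.+ n)) ⟨
    ℤ.+ m ℤ.* ℤ.+ 1 ℤ.+ ℤ.+ n ℤ.* ℤ.+ 1               ≡⟨ ℤ.*-identityʳ _ ⟨
    (ℤ.+ m ℤ.* ℤ.+ 1 ℤ.+ ℤ.+ n ℤ.* ℤ.+ 1) ℤ.* ℤ.+ 1   ∎
    where open ≡-Reasoning

ℕ→ℚ-mono-≤ : ∀ {m n} → m ≤ n → ℕ→ℚ m ℚ.≤ ℕ→ℚ n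
ℕ→ℚ-mono-≤ {m} {n} m≤n rewrite ℕ→ℚ≡fromℕ m | ℕ→ℚ≡fromℕ n =
  ℚ.*≤* (subst₂ ℤ._≤_ (sym (ℤ.*-identityʳ (ℤ.+ m))) (sym (ℤ.*-identityʳ (ℤ.+ n))) (ℤ.+≤+ m≤n))

ℕ→ℚ-cancel-≤ : ∀ {m n} → ℕ→ℚ m ℚ.≤ ℕ→ℚ n → m ≤ n
ℕ→ℚ-cancel-≤ {m} {n} m≤n rewrite ℕ→ℚ≡fromℕ m | ℕ→ℚ≡fromℕ n with m≤n
... | ℚ.*≤* m*1≤n*1 = ℤ.drop‿+≤+ (subst₂ ℤ._≤_ (ℤ.*-identityʳ (ℤ.+ m)) (ℤ.*-identityʳ (ℤ.+ n)) m*1≤n*1)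

ℕ→ℚ-*-mono-≤ : ∀ m {p q} → p ℚ.≤ q → ℕ→ℚ m ℚ.* p ℚ.≤ ℕ→ℚ m ℚ.* q
ℕ→ℚ-*-mono-≤ m p≤q rewrite ℕ→ℚ≡fromℕ m = ℚ.*-monoˡ-≤-nonNeg _ p≤q

ℕ→ℚ-*-cancel-≤ : ∀ m .{{_ : NonZero m}} {p q} → ℕ→ℚ m ℚ.* p ℚ.≤ ℕ→ℚ m ℚ.* q → p ℚ.≤ q
ℕ→ℚ-*-cancel-≤ (suc m) mp≤mq rewrite ℕ→ℚ≡fromℕ (suc m) = ℚ.*-cancelˡ-≤-pos _ mp≤mq

sumℚ-ones : {A : Set} (xs : List A) → sumℚ (map (λ _ → 1ℚ) xs) ≡ ℕ→ℚ (length xs)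
sumℚ-ones []       = refl
sumℚ-ones (x ∷ xs) = trans (cong (1ℚ ℚ.+_) (sumℚ-ones xs)) (sym (ℕ→ℚ-+ 1 (length xs)))

ℕ→ℚ-*-divisible : ∀ m p → 0ℚ ℚ.≤ p → ↧ₙ p ∣ m → ℕ→ℚ m ℚ.* p ≡ ℕ→ℚ (∣ ↥ p ∣ * (m / ↧ₙ p))
ℕ→ℚ-*-divisible m (mkℚ ℤ.-[1+ a ] d-1 _) (ℚ.*≤* ())
ℕ→ℚ-*-divisible .(q * suc d-1) p@(mkℚ (ℤ.+ a) d-1 _) _ (divides q refl) =
  trans scaled (cong (λ k → ℕ→ℚ (a * k)) (sym (m*n/n≡m q (suc d-1))))
  where
  cross : (ℤ.+ (q * suc d-1) ℤ.* ℤ.+ a) ℤ.* ℤ.+ 1 ≡ ℤ.+ (a * q) ℤ.* ℤ.+ (1 * suc d-1)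
  cross = begin
    (ℤ.+ (q * suc d-1) ℤ.* ℤ.+ a) ℤ.* ℤ.+ 1 ≡⟨ cong (ℤ._* ℤ.+ 1) (ℤ.pos-* (q * suc d-1) a) ⟨
    ℤ.+ (q * suc d-1 * a) ℤ.* ℤ.+ 1         ≡⟨ ℤ.pos-* (q * suc d-1 * a) 1 ⟨
    ℤ.+ (q * suc d-1 * a * 1)               ≡⟨ cong ℤ.+_ (rearrange q d-1 a) ⟩
    ℤ.+ (a * q * (1 * suc d-1))             ≡⟨ ℤ.pos-* (a * q) (1 * suc d-1) ⟩
    ℤ.+ (a * q) ℤ.* ℤ.+ (1 * suc d-1)       ∎
    where
    open ≡-Reasoning
    rearrange : ∀ q d a → q * suc d * a * 1 ≡ a * q * (1 * suc d)
    rearrange = solve-∀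
  scaled : ℕ→ℚ (q * suc d-1) ℚ.* p ≡ ℕ→ℚ (a * q)
  scaled rewrite ℕ→ℚ≡fromℕ (q * suc d-1) | ℕ→ℚ≡fromℕ (a * q) =
    ℚ.toℚᵘ-injective (ℚᵘ.≃-trans (ℚ.toℚᵘ-homo-* (fromℕ (q * suc d-1)) p) (ℚᵘ.*≡* cross))

sumℚ-filterᵇ-scaled : {A : Set} (c : ℚ) (p : A → Bool) (f : A → ℚ) (g : A → ℕ)
                    → (∀ x → p x ≡ true → c ℚ.* f x ≡ ℕ→ℚ (g x))
                    → ∀ xs → c ℚ.* sumℚ (map f (filterᵇ p xs)) ≡ ℕ→ℚ (∑[ x ∈ xs ] ⟦ p x ⟧ * g x)
sumℚ-filterᵇ-scaled c p f g cf≡g []       = ℚ.*-zeroʳ c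
sumℚ-filterᵇ-scaled c p f g cf≡g (x ∷ xs) with p x in px
... | false = sumℚ-filterᵇ-scaled c p f g cf≡g xs
... | true  = begin
  c ℚ.* (f x ℚ.+ sumℚ (map f (filterᵇ p xs)))     ≡⟨ ℚ.*-distribˡ-+ c (f x) _ ⟩
  c ℚ.* f x ℚ.+ c ℚ.* sumℚ (map f (filterᵇ p xs)) ≡⟨ cong₂ ℚ._+_ (cf≡g x px) (sumℚ-filterᵇ-scaled c p f g cf≡g xs) ⟩
  ℕ→ℚ (g x) ℚ.+ ℕ→ℚ rest                          ≡⟨ ℕ→ℚ-+ (g x) rest ⟨
  ℕ→ℚ (g x + rest)                                ≡⟨ cong (λ k → ℕ→ℚ (k + rest)) (*-identityˡ (g x)) ⟨
  ℕ→ℚ (1 * g x + rest)                            ∎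
  where
  open ≡-Reasoning
  rest : ℕ
  rest = ∑[ y ∈ xs ] ⟦ p y ⟧ * g y

-- The activation process

module ProcessProperties (G : FinGraph) (w : FinGraph.V G → FinGraph.V G → ℚ) (τ : FinGraph.V G → ℚ) where
  open FinGraph G
  open Process G w τ

  step-⊇ : ∀ S v → S v ≡ true → step S v ≡ true
  step-⊇ S v Sv = cong (_∨ (τ v ℚ.≤ᵇ received S v)) Sv

  step-activates : ∀ S v → (S v ≡ false → τ v ℚ.≤ received S v) → step S v ≡ true
  step-activates S v τ≤ with S v
  ... | true  = refl
  ... | false = Equivalence.to T-≡ (ℚ.≤⇒≤ᵇ (τ≤ refl))

  step-active : ∀ S v → step S v ≡ true → S v ≡ true ⊎ τ v ℚ.≤ received S v
  step-active S v act with S v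
  ... | true  = inj₁ refl
  ... | false = inj₂ (ℚ.≤ᵇ⇒≤ (Equivalence.from T-≡ act))

  received-scaled : (c : ℚ) (k : V → V → ℕ) → (∀ u v → adj u v ≡ true → c ℚ.* w u v ≡ ℕ→ℚ (k u v))
                  → ∀ S u → c ℚ.* received S u ≡ ℕ→ℚ (∑[ v ∈ verts ] ⟦ adj u v ∧ S v ⟧ * k u v)
  received-scaled c k cw≡k S u =
    sumℚ-filterᵇ-scaled c (λ v → adj u v ∧ S v) (w u) (k u) (λ v → cw≡k u v ∘ ∧-conicalˡ (adj u v) (S v)) verts

received-unit : (H : FinGraph) (τ' : FinGraph.V H → ℚ) (S : FinGraph.V H → Bool) (x : FinGraph.V H)
              → Process.received H (λ _ _ → 1ℚ) τ' S x ≡ ℕ→ℚ (∑[ y ∈ FinGraph.verts H ] ⟦ FinGraph.adj H x y ∧ S y ⟧)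
received-unit H τ' S x = trans (sumℚ-ones (filterᵇ p verts)) (cong ℕ→ℚ (length-filterᵇ p verts))
  where
  open FinGraph H
  p : V → Bool
  p y = adj x y ∧ S y

MinimumIs : {A : Set} → (A → Set) → (A → ℕ) → ℕ → Set
MinimumIs P size k = (∃ λ a → P a × size a ≡ k) × (∀ a → P a → k ≤ size a)

minimumIs-transfer : {A B : Set} {P : A → Set} {Q : B → Set} {∣_∣ᴬ : A → ℕ} {∣_∣ᴮ : B → ℕ}
  → (f : A → B) → (∀ {a} → P a → Q (f a)) → (∀ a → ∣ f a ∣ᴮ ≡ ∣ a ∣ᴬ)
  → (g : B → A) → (∀ {b} → Q b → P (g b)) → (∀ b → ∣ g b ∣ᴬ ≤ ∣ b ∣ᴮ)
  → ∀ k → MinimumIs P ∣_∣ᴬ k ⇔ MinimumIs Q ∣_∣ᴮ k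
minimumIs-transfer {P = P} {Q} {∣_∣ᴬ} {∣_∣ᴮ} f P⇒Q ∣f∣ g Q⇒P ∣g∣ k = mk⇔ to from
  where
  to : MinimumIs P ∣_∣ᴬ k → MinimumIs Q ∣_∣ᴮ k
  to ((a , Pa , ∣a∣≡k) , min) =
    (f a , P⇒Q Pa , trans (∣f∣ a) ∣a∣≡k) , λ b Qb → ≤-trans (min (g b) (Q⇒P Qb)) (∣g∣ b)
  from : MinimumIs Q ∣_∣ᴮ k → MinimumIs P ∣_∣ᴬ k
  from ((b , Qb , ∣b∣≡k) , min) =
    (g b , Q⇒P Qb , ≤-antisym (subst (∣ g b ∣ᴬ ≤_) ∣b∣≡k (∣g∣ b)) (k≤ (g b) (Q⇒P Qb))) , k≤
    where
    k≤ : ∀ a → P a → k ≤ ∣ a ∣ᴬ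
    k≤ a Pa = subst (k ≤_) (∣f∣ a) (min (f a) (P⇒Q Pa))

-- The graph H(G,w)

module Reduction (n : ℕ) (adj : Fin n → Fin n → Bool) (w : Fin n → Fin n → ℚ) (τ : Fin n → ℚ)
  (adj-sym : ∀ u v → adj u v ≡ adj v u) (adj-irrefl : ∀ u → adj u u ≡ false)
  (w-sym : ∀ u v → adj u v ≡ true → w u v ≡ w v u)
  (w-nonneg : ∀ u v → adj u v ≡ true → 0ℚ ℚ.≤ w u v) where

  open Construction n adj w

  module 𝒢 where
    open Process G w τ public
    open ProcessProperties G w τ public

  module ℋ where
    open Process H (λ _ _ → 1ℚ) (τ' τ) public
    open ProcessProperties H (λ _ _ → 1ℚ) (τ' τ) public

  instance
    ℓ-nonZero : NonZero ℓ
    ℓ-nonZero = foldr-lcm-nonZero (λ p → ↧ₙ w (proj₁ p) (proj₂ p)) (λ _ → _) edgePairs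

  ↧w∣ℓ : ∀ u v → adj u v ≡ true → ↧ₙ (w u v) ∣ ℓ
  ↧w∣ℓ u v uv = ∣-foldr-lcm (∈-map⁺ (λ p → ↧ₙ w (proj₁ p) (proj₂ p))
    (∈-filter⁺ (T? ∘ λ p → adj (proj₁ p) (proj₂ p))
      (∈-cartesianProduct⁺ (∈-allFin u) (∈-allFin v)) (Equivalence.from T-≡ uv)))

  ℓ*w≡kk : ∀ u v → adj u v ≡ true → ℕ→ℚ ℓ ℚ.* w u v ≡ ℕ→ℚ (kk u v)
  ℓ*w≡kk u v uv = ℕ→ℚ-*-divisible ℓ (w u v) (w-nonneg u v uv) (↧w∣ℓ u v uv)

  kk-sym : ∀ u v → adj u v ≡ true → kk u v ≡ kk v u
  kk-sym u v uv = cong (λ q → ∣ ↥ q ∣ * (ℓ / ↧ₙ q)) (w-sym u v uv)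

  mids-unordered : ∀ a b → ¬ toℕ a < toℕ b → mids (a , b) ≡ 0
  mids-unordered a b a≮b = cong (λ c → if c ∧ adj a b then kk a b ∸ 1 else 0) (<ᵇ-false a≮b)

  mids-ordered : ∀ a b → toℕ a < toℕ b → adj a b ≡ true → mids (a , b) ≡ kk a b ∸ 1
  mids-ordered a b a<b ab = cong₂ (λ c d → if c ∧ d then kk a b ∸ 1 else 0) (<ᵇ-true a<b) ab

  mids-nonadjacent : ∀ a b → adj a b ≡ false → mids (a , b) ≡ 0
  mids-nonadjacent a b ab =
    cong (λ c → if c then kk a b ∸ 1 else 0) (trans (cong ((toℕ a <ᵇ toℕ b) ∧_) ab) (∧-zeroʳ _))

  mids-between : ∀ u v → mids (u , v) + mids (v , u) ≡ ⟦ adj u v ⟧ * (kk u v ∸ 1)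
  mids-between u v = by-adjacency (adj u v) refl
    where
    by-adjacency : ∀ b → adj u v ≡ b → mids (u , v) + mids (v , u) ≡ ⟦ b ⟧ * (kk u v ∸ 1)
    by-adjacency false uv = cong₂ _+_ (mids-nonadjacent u v uv) (mids-nonadjacent v u (trans (adj-sym v u) uv))
    by-adjacency true uv with <-cmp (toℕ u) (toℕ v)
    ... | tri< u<v _ v≮u = begin
      mids (u , v) + mids (v , u) ≡⟨ cong₂ _+_ (mids-ordered u v u<v uv) (mids-unordered v u v≮u) ⟩
      (kk u v ∸ 1) + 0            ≡⟨ +-identityʳ _ ⟩
      kk u v ∸ 1                  ≡⟨ *-identityˡ _ ⟨
      1 * (kk u v ∸ 1)            ∎
      where open ≡-Reasoning
    ... | tri> u≮v _ v<u = begin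
      mids (u , v) + mids (v , u) ≡⟨ cong₂ _+_ (mids-unordered u v u≮v) (mids-ordered v u v<u (trans (adj-sym v u) uv)) ⟩
      kk v u ∸ 1                  ≡⟨ cong (_∸ 1) (kk-sym u v uv) ⟨
      kk u v ∸ 1                  ≡⟨ *-identityˡ _ ⟨
      1 * (kk u v ∸ 1)            ∎
      where open ≡-Reasoning
    ... | tri≈ _ u≡v _ =
      contradiction (trans (sym uv) (trans (cong (adj u) (sym (toℕ-injective u≡v))) (adj-irrefl u))) λ ()

  activeMiddles : (VH → Bool) → Fin n × Fin n → ℕ
  activeMiddles SH p = ∑[ j ∈ allFin (mids p) ] ⟦ SH (inj₂ (p , j)) ⟧

  gadgetCount : (VH → Bool) → Fin n → Fin n → ℕ
  gadgetCount SH u v =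
    ⟦ adjH (inj₁ u) (inj₁ v) ∧ SH (inj₁ v) ⟧ + (activeMiddles SH (u , v) + activeMiddles SH (v , u))

  gadget-size : ∀ u v → ⟦ adjH (inj₁ u) (inj₁ v) ⟧ + (mids (u , v) + mids (v , u)) ≡ ⟦ adj u v ⟧ * kk u v
  gadget-size u v = begin
    ⟦ adj u v ∧ (1 ℕ.≤ᵇ kk u v) ⟧ + (mids (u , v) + mids (v , u))
      ≡⟨ cong₂ _+_ (⟦∧⟧ (adj u v) _) (mids-between u v) ⟩
    ⟦ adj u v ⟧ * ⟦ 1 ℕ.≤ᵇ kk u v ⟧ + ⟦ adj u v ⟧ * (kk u v ∸ 1)
      ≡⟨ *-distribˡ-+ ⟦ adj u v ⟧ _ _ ⟨
    ⟦ adj u v ⟧ * (⟦ 1 ℕ.≤ᵇ kk u v ⟧ + (kk u v ∸ 1))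
      ≡⟨ cong (⟦ adj u v ⟧ *_) (⟦1≤ᵇ⟧+∸1 (kk u v)) ⟩
    ⟦ adj u v ⟧ * kk u v
      ∎
    where open ≡-Reasoning

  gadgetCount-≤ : (SH : VH → Bool) (u v : Fin n) → gadgetCount SH u v ≤ ⟦ adj u v ⟧ * kk u v
  gadgetCount-≤ SH u v = ≤-trans
    (+-mono-≤ (⟦∧⟧≤ˡ (adjH (inj₁ u) (inj₁ v)) _)
              (+-mono-≤ (∑-allFin-≤-length (mids (u , v)) (λ _ → ⟦⟧≤1 _))
                        (∑-allFin-≤-length (mids (v , u)) (λ _ → ⟦⟧≤1 _))))
    (≤-reflexive (gadget-size u v))

  gadgetCount-full : (SH : VH → Bool) (u v : Fin n) → SH (inj₁ v) ≡ true
    → (∀ j → SH (inj₂ ((u , v) , j)) ≡ true) → (∀ j → SH (inj₂ ((v , u) , j)) ≡ true)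
    → gadgetCount SH u v ≡ ⟦ adj u v ⟧ * kk u v
  gadgetCount-full SH u v v-on uv-on vu-on = trans
    (cong₂ _+_ (cong ⟦_⟧ (trans (cong (adjH (inj₁ u) (inj₁ v) ∧_) v-on) (∧-identityʳ _)))
               (cong₂ _+_ (∑-allFin-length (mids (u , v)) (cong ⟦_⟧ ∘ uv-on))
                          (∑-allFin-length (mids (v , u)) (cong ⟦_⟧ ∘ vu-on))))
    (gadget-size u v)

  gadgetCount-empty : (SH : VH → Bool) (u v : Fin n) → SH (inj₁ v) ≡ false
    → (∀ j → SH (inj₂ ((u , v) , j)) ≡ false) → (∀ j → SH (inj₂ ((v , u) , j)) ≡ false)
    → gadgetCount SH u v ≡ 0
  gadgetCount-empty SH u v v-off uv-off vu-off =
    cong₂ _+_ (cong ⟦_⟧ (trans (cong (adjH (inj₁ u) (inj₁ v) ∧_) v-off) (∧-zeroʳ _)))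
              (cong₂ _+_ (∑-zero (cong ⟦_⟧ ∘ uv-off) (allFin (mids (u , v))))
                         (∑-zero (cong ⟦_⟧ ∘ vu-off) (allFin (mids (v , u)))))

  ∑-middles : (Mid → ℕ) → ℕ
  ∑-middles F = ∑[ a ∈ allFin n ] ∑[ b ∈ allFin n ] ∑[ j ∈ allFin (mids (a , b)) ] F ((a , b) , j)

  ∑-middles-zero : ∑-middles (λ _ → 0) ≡ 0
  ∑-middles-zero = ∑-zero (λ a → ∑-zero (λ b → ∑-zero (λ _ → refl) (allFin (mids (a , b)))) (allFin n)) (allFin n)

  ∑-VH : (F : VH → ℕ) → ∑ (FinGraph.verts H) F ≡ (∑[ v ∈ allFin n ] F (inj₁ v)) + ∑-middles (F ∘ inj₂)
  ∑-VH F = begin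
    ∑ (map inj₁ (allFin n) ++ map inj₂ midList) F
      ≡⟨ ∑-++ F (map inj₁ (allFin n)) _ ⟩
    ∑ (map inj₁ (allFin n)) F + ∑ (map inj₂ midList) F
      ≡⟨ cong₂ _+_ (∑-map F inj₁ (allFin n)) (∑-map F inj₂ midList) ⟩
    (∑[ v ∈ allFin n ] F (inj₁ v)) + (∑[ m ∈ midList ] F (inj₂ m))
      ≡⟨ cong (_ +_) (∑-concatMap (F ∘ inj₂) (λ p → map (p ,_) (allFin (mids p))) pairs) ⟩
    (∑[ v ∈ allFin n ] F (inj₁ v)) + (∑[ p ∈ pairs ] ∑ (map (p ,_) (allFin (mids p))) (F ∘ inj₂))
      ≡⟨ cong (_ +_) (∑-cong (λ p → ∑-map (F ∘ inj₂) (p ,_) (allFin (mids p))) pairs) ⟩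
    (∑[ v ∈ allFin n ] F (inj₁ v)) + (∑[ p ∈ pairs ] ∑[ j ∈ allFin (mids p) ] F (inj₂ (p , j)))
      ≡⟨ cong (_ +_) (∑-cartesianProduct (λ p → ∑[ j ∈ allFin (mids p) ] F (inj₂ (p , j))) (allFin n) (allFin n)) ⟩
    (∑[ v ∈ allFin n ] F (inj₁ v)) + ∑-middles (F ∘ inj₂)
      ∎
    where open ≡-Reasoning

  activeMiddles-diagonal : (SH : VH → Bool) (a b : Fin n) → toℕ a ≡ toℕ b → activeMiddles SH (a , b) ≡ 0
  activeMiddles-diagonal SH a b a≡b = n≤0⇒n≡0 (subst (activeMiddles SH (a , b) ≤_)
    (mids-unordered a b (<-irrefl a≡b)) (∑-allFin-≤-length (mids (a , b)) (λ _ → ⟦⟧≤1 _)))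

  middles-around : (SH : VH → Bool) (u : Fin n)
    → ∑-middles (λ m → ⟦ adjH (inj₁ u) (inj₂ m) ∧ SH (inj₂ m) ⟧)
    ≡ (∑[ v ∈ allFin n ] activeMiddles SH (u , v)) + (∑[ v ∈ allFin n ] activeMiddles SH (v , u))
  middles-around SH u = begin
    (∑[ a ∈ allFin n ] ∑[ b ∈ allFin n ] ∑[ j ∈ allFin (mids (a , b)) ] ⟦ (eqF u a ∨ eqF u b) ∧ SH (inj₂ ((a , b) , j)) ⟧)
      ≡⟨ ∑-cong (λ a → ∑-cong (λ b → pair a b) (allFin n)) (allFin n) ⟩
    (∑[ a ∈ allFin n ] ∑[ b ∈ allFin n ] ⟦ eqF u a ⟧ * M a b + ⟦ eqF u b ⟧ * M a b)
      ≡⟨ ∑-cong (λ a → ∑-+ (λ b → ⟦ eqF u a ⟧ * M a b) (λ b → ⟦ eqF u b ⟧ * M a b) (allFin n)) (allFin n) ⟩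
    (∑[ a ∈ allFin n ] (∑[ b ∈ allFin n ] ⟦ eqF u a ⟧ * M a b) + (∑[ b ∈ allFin n ] ⟦ eqF u b ⟧ * M a b))
      ≡⟨ ∑-+ (λ a → ∑[ b ∈ allFin n ] ⟦ eqF u a ⟧ * M a b) (λ a → ∑[ b ∈ allFin n ] ⟦ eqF u b ⟧ * M a b)
             (allFin n) ⟩
    (∑[ a ∈ allFin n ] ∑[ b ∈ allFin n ] ⟦ eqF u a ⟧ * M a b) + (∑[ a ∈ allFin n ] ∑[ b ∈ allFin n ] ⟦ eqF u b ⟧ * M a b)
      ≡⟨ cong₂ _+_ (∑-cong (λ a → ∑-*ˡ ⟦ eqF u a ⟧ (M a) (allFin n)) (allFin n))
                   (∑-cong (λ a → ∑-deltaˡ u (M a)) (allFin n)) ⟩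
    (∑[ a ∈ allFin n ] ⟦ eqF u a ⟧ * (∑[ b ∈ allFin n ] M a b)) + (∑[ a ∈ allFin n ] M a u)
      ≡⟨ cong (_+ (∑[ a ∈ allFin n ] M a u)) (∑-deltaˡ u (λ a → ∑[ b ∈ allFin n ] M a b)) ⟩
    (∑[ b ∈ allFin n ] M u b) + (∑[ a ∈ allFin n ] M a u)
      ∎
    where
    open ≡-Reasoning
    M : Fin n → Fin n → ℕ
    M a b = activeMiddles SH (a , b)
    pair : ∀ a b → (∑[ j ∈ allFin (mids (a , b)) ] ⟦ (eqF u a ∨ eqF u b) ∧ SH (inj₂ ((a , b) , j)) ⟧)
                 ≡ ⟦ eqF u a ⟧ * M a b + ⟦ eqF u b ⟧ * M a b
    pair a b = begin
      (∑[ j ∈ allFin (mids (a , b)) ] ⟦ (eqF u a ∨ eqF u b) ∧ SH (inj₂ ((a , b) , j)) ⟧)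
        ≡⟨ ∑-cong (λ j → ⟦∧⟧ (eqF u a ∨ eqF u b) _) (allFin (mids (a , b))) ⟩
      (∑[ j ∈ allFin (mids (a , b)) ] ⟦ eqF u a ∨ eqF u b ⟧ * ⟦ SH (inj₂ ((a , b) , j)) ⟧)
        ≡⟨ ∑-*ˡ ⟦ eqF u a ∨ eqF u b ⟧ (λ j → ⟦ SH (inj₂ ((a , b) , j)) ⟧) (allFin (mids (a , b))) ⟩
      ⟦ eqF u a ∨ eqF u b ⟧ * M a b
        ≡⟨ ⟦∨⟧-*-split (eqF u a) (eqF u b) (M a b)
             (activeMiddles-diagonal SH a b ∘ ≡ᵇ-∧-≡ᵇ (toℕ u) (toℕ a) (toℕ b)) ⟩
      ⟦ eqF u a ⟧ * M a b + ⟦ eqF u b ⟧ * M a b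
        ∎

  original-neighbours : (SH : VH → Bool) (u : Fin n)
    → (∑[ y ∈ FinGraph.verts H ] ⟦ adjH (inj₁ u) y ∧ SH y ⟧) ≡ (∑[ v ∈ allFin n ] gadgetCount SH u v)
  original-neighbours SH u = begin
    (∑[ y ∈ FinGraph.verts H ] ⟦ adjH (inj₁ u) y ∧ SH y ⟧)
      ≡⟨ ∑-VH (λ y → ⟦ adjH (inj₁ u) y ∧ SH y ⟧) ⟩
    E + ∑-middles (λ m → ⟦ adjH (inj₁ u) (inj₂ m) ∧ SH (inj₂ m) ⟧)
      ≡⟨ cong (E +_) (middles-around SH u) ⟩
    E + ((∑[ v ∈ allFin n ] activeMiddles SH (u , v)) + (∑[ v ∈ allFin n ] activeMiddles SH (v , u)))
      ≡⟨ cong (E +_) (∑-+ (λ v → activeMiddles SH (u , v)) (λ v → activeMiddles SH (v , u)) (allFin n)) ⟨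
    E + (∑[ v ∈ allFin n ] activeMiddles SH (u , v) + activeMiddles SH (v , u))
      ≡⟨ ∑-+ (λ v → ⟦ adjH (inj₁ u) (inj₁ v) ∧ SH (inj₁ v) ⟧)
             (λ v → activeMiddles SH (u , v) + activeMiddles SH (v , u)) (allFin n) ⟨
    (∑[ v ∈ allFin n ] gadgetCount SH u v)
      ∎
    where
    open ≡-Reasoning
    E : ℕ
    E = ∑[ v ∈ allFin n ] ⟦ adjH (inj₁ u) (inj₁ v) ∧ SH (inj₁ v) ⟧

  middle-neighbours : (SH : VH → Bool) (a b : Fin n) (j : Fin (mids (a , b)))
    → (∑[ y ∈ FinGraph.verts H ] ⟦ adjH (inj₂ ((a , b) , j)) y ∧ SH y ⟧) ≡ ⟦ SH (inj₁ a) ⟧ + ⟦ SH (inj₁ b) ⟧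
  middle-neighbours SH a b j = begin
    (∑[ y ∈ FinGraph.verts H ] ⟦ adjH (inj₂ ((a , b) , j)) y ∧ SH y ⟧)
      ≡⟨ ∑-VH (λ y → ⟦ adjH (inj₂ ((a , b) , j)) y ∧ SH y ⟧) ⟩
    (∑[ v ∈ allFin n ] ⟦ (eqF v a ∨ eqF v b) ∧ SH (inj₁ v) ⟧) + ∑-middles (λ _ → 0)
      ≡⟨ cong ((∑[ v ∈ allFin n ] ⟦ (eqF v a ∨ eqF v b) ∧ SH (inj₁ v) ⟧) +_) ∑-middles-zero ⟩
    (∑[ v ∈ allFin n ] ⟦ (eqF v a ∨ eqF v b) ∧ SH (inj₁ v) ⟧) + 0
      ≡⟨ +-identityʳ _ ⟩
    (∑[ v ∈ allFin n ] ⟦ (eqF v a ∨ eqF v b) ∧ SH (inj₁ v) ⟧)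
      ≡⟨ ∑-cong split (allFin n) ⟩
    (∑[ v ∈ allFin n ] ⟦ eqF v a ⟧ * s v + ⟦ eqF v b ⟧ * s v)
      ≡⟨ ∑-+ (λ v → ⟦ eqF v a ⟧ * s v) (λ v → ⟦ eqF v b ⟧ * s v) (allFin n) ⟩
    (∑[ v ∈ allFin n ] ⟦ eqF v a ⟧ * s v) + (∑[ v ∈ allFin n ] ⟦ eqF v b ⟧ * s v)
      ≡⟨ cong₂ _+_ (∑-delta a s) (∑-delta b s) ⟩
    s a + s b
      ∎
    where
    open ≡-Reasoning
    s : Fin n → ℕ
    s v = ⟦ SH (inj₁ v) ⟧
    ends-distinct : toℕ a ≢ toℕ b
    ends-distinct a≡b with subst Fin (mids-unordered a b (<-irrefl a≡b)) j
    ... | ()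
    split : ∀ v → ⟦ (eqF v a ∨ eqF v b) ∧ SH (inj₁ v) ⟧ ≡ ⟦ eqF v a ⟧ * s v + ⟦ eqF v b ⟧ * s v
    split v = trans (⟦∧⟧ (eqF v a ∨ eqF v b) (SH (inj₁ v)))
      (⟦∨⟧-*-split (eqF v a) (eqF v b) (s v)
        (λ both → contradiction (≡ᵇ-∧-≡ᵇ (toℕ v) (toℕ a) (toℕ b) both) ends-distinct))

  weighted-received : ∀ S u → ℕ→ℚ ℓ ℚ.* 𝒢.received S u ≡ ℕ→ℚ (∑[ v ∈ allFin n ] ⟦ adj u v ∧ S v ⟧ * kk u v)
  weighted-received = 𝒢.received-scaled (ℕ→ℚ ℓ) kk ℓ*w≡kk

  original-received : ∀ SH u → ℋ.received SH (inj₁ u) ≡ ℕ→ℚ (∑[ v ∈ allFin n ] gadgetCount SH u v)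
  original-received SH u = trans (received-unit H (τ' τ) SH (inj₁ u)) (cong ℕ→ℚ (original-neighbours SH u))

  middle-received : ∀ SH a b j → ℋ.received SH (inj₂ ((a , b) , j)) ≡ ℕ→ℚ (⟦ SH (inj₁ a) ⟧ + ⟦ SH (inj₁ b) ⟧)
  middle-received SH a b j = trans (received-unit H (τ' τ) SH (inj₂ ((a , b) , j))) (cong ℕ→ℚ (middle-neighbours SH a b j))

  lift : (Fin n → Bool) → VH → Bool
  lift D (inj₁ u) = D u
  lift D (inj₂ _) = false

  _⊑_ : (Fin n → Bool) → (VH → Bool) → Set
  S ⊑ SH = ∀ v → S v ≡ true → SH (inj₁ v) ≡ true

  _⊑ᴹ_ : (Fin n → Bool) → (VH → Bool) → Set
  S ⊑ᴹ SH = ∀ a b j → S a ≡ true ⊎ S b ≡ true → SH (inj₂ ((a , b) , j)) ≡ true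

  gadgetCount-lower : ∀ {S SH} → S ⊑ SH → S ⊑ᴹ SH → ∀ u v → ⟦ adj u v ∧ S v ⟧ * kk u v ≤ gadgetCount SH u v
  gadgetCount-lower {S} {SH} S⊑SH S⊑ᴹSH u v with S v in Sv
  ... | false rewrite ∧-zeroʳ (adj u v) = z≤n
  ... | true  rewrite ∧-identityʳ (adj u v) = ≤-reflexive (sym
    (gadgetCount-full SH u v (S⊑SH v Sv) (λ j → S⊑ᴹSH u v j (inj₂ Sv)) (λ j → S⊑ᴹSH v u j (inj₁ Sv))))

  step-activates-middles : ∀ {S SH} → S ⊑ SH → S ⊑ᴹ ℋ.step SH
  step-activates-middles {S} {SH} S⊑SH a b j Sa⊎Sb = ℋ.step-activates SH (inj₂ ((a , b) , j)) λ _ →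
    (subst (1ℚ ℚ.≤_) (sym (middle-received SH a b j)) (ℕ→ℚ-mono-≤ (true⊎true⇒1≤⟦⟧+⟦⟧ _ _ end-active)))
    where
    end-active : SH (inj₁ a) ≡ true ⊎ SH (inj₁ b) ≡ true
    end-active = Sum.map (S⊑SH a) (S⊑SH b) Sa⊎Sb

  step-lifts : ∀ {S SH} → S ⊑ SH → S ⊑ᴹ SH → 𝒢.step S ⊑ ℋ.step SH
  step-lifts {S} {SH} S⊑SH S⊑ᴹSH u stepSu with 𝒢.step-active S u stepSu
  ... | inj₁ Su = ℋ.step-⊇ SH (inj₁ u) (S⊑SH u Su)
  ... | inj₂ τ≤ = ℋ.step-activates SH (inj₁ u) λ _ → (begin
    ℕ→ℚ ℓ ℚ.* τ u                                     ≤⟨ ℕ→ℚ-*-mono-≤ ℓ τ≤ ⟩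
    ℕ→ℚ ℓ ℚ.* 𝒢.received S u                          ≡⟨ weighted-received S u ⟩
    ℕ→ℚ (∑[ v ∈ allFin n ] ⟦ adj u v ∧ S v ⟧ * kk u v) ≤⟨ ℕ→ℚ-mono-≤ (∑-mono (gadgetCount-lower {S} {SH} S⊑SH S⊑ᴹSH u) (allFin n)) ⟩
    ℕ→ℚ (∑[ v ∈ allFin n ] gadgetCount SH u v)         ≡⟨ original-received SH u ⟨
    ℋ.received SH (inj₁ u)                             ∎)
    where open ℚ.≤-Reasoning

  lift-simulates : ∀ D i → ∃ λ k → 𝒢.phase i D ⊑ ℋ.phase k (lift D)
  lift-simulates D zero    = 0 , λ v Dv → Dv
  lift-simulates D (suc i) with lift-simulates D i
  ... | k , S⊑SH = suc (suc k) , step-lifts (λ v Sv → ℋ.step-⊇ _ (inj₁ v) (S⊑SH v Sv)) (step-activates-middles S⊑SH)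

  lift-monopoly : ∀ {D} → 𝒢.IsDynMonopoly D → ℋ.IsDynMonopoly (lift D)
  lift-monopoly {D} (i , all-active) with lift-simulates D i
  ... | k , S⊑SH = suc k , λ where
    (inj₁ u)             → ℋ.step-⊇ _ (inj₁ u) (S⊑SH u (all-active u))
    (inj₂ ((a , b) , j)) → step-activates-middles S⊑SH a b j (inj₁ (all-active a))

  lift-size : ∀ D → ℋ.size (lift D) ≡ 𝒢.size D
  lift-size D = begin
    length (filterᵇ (lift D) (FinGraph.verts H))
      ≡⟨ length-filterᵇ (lift D) (FinGraph.verts H) ⟩
    ∑ (FinGraph.verts H) (⟦_⟧ ∘ lift D)
      ≡⟨ ∑-VH (⟦_⟧ ∘ lift D) ⟩
    (∑[ v ∈ allFin n ] ⟦ D v ⟧) + ∑-middles (λ _ → 0)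
      ≡⟨ cong ((∑[ v ∈ allFin n ] ⟦ D v ⟧) +_) ∑-middles-zero ⟩
    (∑[ v ∈ allFin n ] ⟦ D v ⟧) + 0
      ≡⟨ +-identityʳ _ ⟩
    (∑[ v ∈ allFin n ] ⟦ D v ⟧)
      ≡⟨ length-filterᵇ D (allFin n) ⟨
    length (filterᵇ D (allFin n))
      ∎
    where open ≡-Reasoning

  record _≼_ (SH : VH → Bool) (S : Fin n → Bool) : Set where
    field
      originals : ∀ v → SH (inj₁ v) ≡ true → S v ≡ true
      middles   : ∀ a b j → SH (inj₂ ((a , b) , j)) ≡ true → S a ≡ true ⊎ S b ≡ true
  open _≼_

  gadgetCount-upper : ∀ {SH S} → SH ≼ S → ∀ u → S u ≡ false → ∀ v → gadgetCount SH u v ≤ ⟦ adj u v ∧ S v ⟧ * kk u v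
  gadgetCount-upper {SH} {S} SH≼S u Su v with S v in Sv
  ... | true  rewrite ∧-identityʳ (adj u v) = gadgetCount-≤ SH u v
  ... | false = ≤-trans (≤-reflexive (gadgetCount-empty SH u v v-off (λ j → middle-off Su Sv) (λ j → middle-off Sv Su))) z≤n
    where
    v-off : SH (inj₁ v) ≡ false
    v-off = ¬-not λ SHv → contradiction (trans (sym (originals SH≼S v SHv)) Sv) λ ()
    middle-off : ∀ {a b j} → S a ≡ false → S b ≡ false → SH (inj₂ ((a , b) , j)) ≡ false
    middle-off {a} {b} {j} Sa Sb = ¬-not λ SHm → case middles SH≼S a b j SHm of λ where
      (inj₁ Sa′) → contradiction (trans (sym Sa′) Sa) λ ()
      (inj₂ Sb′) → contradiction (trans (sym Sb′) Sb) λ ()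

  step-projects : ∀ {SH S} → SH ≼ S → ℋ.step SH ≼ 𝒢.step S
  originals (step-projects {SH} {S} SH≼S) u stepSHu with ℋ.step-active SH (inj₁ u) stepSHu
  ... | inj₁ SHu = 𝒢.step-⊇ S u (originals SH≼S u SHu)
  ... | inj₂ ℓτ≤ = 𝒢.step-activates S u λ Su → ℕ→ℚ-*-cancel-≤ ℓ (begin
    ℕ→ℚ ℓ ℚ.* τ u                                     ≤⟨ ℓτ≤ ⟩
    ℋ.received SH (inj₁ u)                             ≡⟨ original-received SH u ⟩
    ℕ→ℚ (∑[ v ∈ allFin n ] gadgetCount SH u v)         ≤⟨ ℕ→ℚ-mono-≤ (∑-mono (gadgetCount-upper SH≼S u Su) (allFin n)) ⟩
    ℕ→ℚ (∑[ v ∈ allFin n ] ⟦ adj u v ∧ S v ⟧ * kk u v) ≡⟨ weighted-received S u ⟨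
    ℕ→ℚ ℓ ℚ.* 𝒢.received S u                          ∎)
    where open ℚ.≤-Reasoning
  middles (step-projects {SH} {S} SH≼S) a b j stepSHm with ℋ.step-active SH (inj₂ ((a , b) , j)) stepSHm
  ... | inj₁ SHm = Sum.map (𝒢.step-⊇ S a) (𝒢.step-⊇ S b) (middles SH≼S a b j SHm)
  ... | inj₂ 1≤ = Sum.map (𝒢.step-⊇ S a ∘ originals SH≼S a) (𝒢.step-⊇ S b ∘ originals SH≼S b)
    (1≤⟦⟧+⟦⟧⇒true⊎true _ _ (ℕ→ℚ-cancel-≤ (subst (1ℚ ℚ.≤_) (middle-received SH a b j) 1≤)))

  project : (VH → Bool) → Fin n → Bool
  project D′ u = D′ (inj₁ u) ∨ (1 ℕ.≤ᵇ ∑[ b ∈ allFin n ] activeMiddles D′ (u , b))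

  ≼-project : ∀ D′ → D′ ≼ project D′
  originals (≼-project D′) u D′u = cong (_∨ (1 ℕ.≤ᵇ ∑[ b ∈ allFin n ] activeMiddles D′ (u , b))) D′u
  middles (≼-project D′) a b j D′m =
    inj₁ (trans (cong (D′ (inj₁ a) ∨_) (Equivalence.to T-≡ (≤⇒≤ᵇ one≤))) (∨-zeroʳ _))
    where
    one≤ : 1 ≤ ∑[ b′ ∈ allFin n ] activeMiddles D′ (a , b′)
    one≤ = ≤-trans (≤-reflexive (cong ⟦_⟧ (sym D′m)))
           (≤-trans (∑-member (λ j′ → ⟦ D′ (inj₂ ((a , b) , j′)) ⟧) (∈-allFin j))
                    (∑-member (λ b′ → activeMiddles D′ (a , b′)) (∈-allFin b)))

  project-simulates : ∀ D′ i → ℋ.phase i D′ ≼ 𝒢.phase i (project D′)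
  project-simulates D′ zero    = ≼-project D′
  project-simulates D′ (suc i) = step-projects (project-simulates D′ i)

  project-monopoly : ∀ {D′} → ℋ.IsDynMonopoly D′ → 𝒢.IsDynMonopoly (project D′)
  project-monopoly {D′} (i , all-active) = i , λ u → originals (project-simulates D′ i) u (all-active (inj₁ u))

  project-size : ∀ D′ → 𝒢.size (project D′) ≤ ℋ.size D′
  project-size D′ = begin
    length (filterᵇ (project D′) (allFin n))
      ≡⟨ length-filterᵇ (project D′) (allFin n) ⟩
    (∑[ u ∈ allFin n ] ⟦ project D′ u ⟧)
      ≤⟨ ∑-mono (λ u → ≤-trans (⟦∨⟧≤ (D′ (inj₁ u)) _) (+-monoʳ-≤ ⟦ D′ (inj₁ u) ⟧ (⟦1≤ᵇ⟧≤ _))) (allFin n) ⟩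
    (∑[ u ∈ allFin n ] ⟦ D′ (inj₁ u) ⟧ + (∑[ b ∈ allFin n ] activeMiddles D′ (u , b)))
      ≡⟨ ∑-+ (λ u → ⟦ D′ (inj₁ u) ⟧) (λ u → ∑[ b ∈ allFin n ] activeMiddles D′ (u , b)) (allFin n) ⟩
    (∑[ u ∈ allFin n ] ⟦ D′ (inj₁ u) ⟧) + ∑-middles (⟦_⟧ ∘ D′ ∘ inj₂)
      ≡⟨ ∑-VH (⟦_⟧ ∘ D′) ⟨
    ∑ (FinGraph.verts H) (⟦_⟧ ∘ D′)
      ≡⟨ length-filterᵇ D′ (FinGraph.verts H) ⟨
    length (filterᵇ D′ (FinGraph.verts H))
      ∎
    where open ≤-Reasoning

proposition3p2 : (n : ℕ) (adj : Fin n → Fin n → Bool) (w : Fin n → Fin n → ℚ) (τ : Fin n → ℚ)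
    → (∀ u v → adj u v ≡ adj v u)
    → (∀ u → adj u u ≡ false)
    → (∀ u v → adj u v ≡ true → w u v ≡ w v u)
    → (∀ u v → adj u v ≡ true → 0ℚ ℚ.≤ w u v)
    → (∀ u → 0ℚ ℚ.≤ τ u)
    → ∀ k → DynW (Construction.G n adj w) w τ k
          ⇔ DynU (Construction.H n adj w) (Construction.τ' n adj w τ) k
proposition3p2 n adj w τ adj-sym adj-irrefl w-sym w-nonneg _ =
  minimumIs-transfer lift lift-monopoly lift-size project project-monopoly project-size
  where open Reduction n adj w τ adj-sym adj-irrefl w-sym w-nonneg
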